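{- Let $k\ge1$, let $\mathbf{k}$ be a complete $k$-profile with $k_1=0$, and let $\pi,\pi'$ be ordered partitions of $[n]$ with profile $\mathbf{k}$. Then, in $G_{n,1/2}$, \[\mathbb{P}(A^{\mathrm{co}}_\pi)=2^k\,\mathbb{P}(A_\pi),\] and if $\pi$ and $\pi'$ have exactly $\ell$ parts in common, where $0\le\ell\le k$, then \[\mathbb{P}(A^{\mathrm{co}}_\pi\cap A^{\mathrm{co}}_{\pi'})\le 2^{2k-\ell}\,\mathbb{P}(A_\pi\cap A_{\pi'}).\]
   Context: $G_{n,1/2}$ is the binomial random graph on $[n]$ with edge probability $1/2$. A $k$-profile is a sequence $(k_u)_{1\le u\le n}$ of nonnegative integers with $\sum_u k_u=k$; it is complete if $\sum_u uk_u=n$. An ordered partition $(V_1,\dots,V_k)$ of $[n]$ has profile $\mathbf{k}$ if exactly $k_u$ of the sets have size $u$ for each $u$ and $|V_1|\ge\dots\ge|V_k|$. $A_\pi$ is the event that every part of $\pi$ is an independent set (i.e. $\pi$ is a colouring), and $A^{\mathrm{co}}_\pi$ is the event that every part of $\pi$ is an independent set or a clique (i.e. $\pi$ is a cocolouring). Two partitions have a part in common if some vertex set is a part of both. -}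

module Defs where

open import Data.Nat using (ℕ; zero; suc; _+_; _*_; _≤_; _<ᵇ_)
open import Data.Bool using (Bool; true; false; _∧_; _∨_; not; if_then_else_; T)
open import Data.Fin using (Fin; toℕ; combine) renaming (_≟_ to _≟ᶠ_)
open import Data.Vec using (Vec; []; _∷_; lookup)
open import Data.List using (List; []; _∷_; _++_; map; length; filter; allFin; foldr)
open import Data.Nat.ListAction using (sum)
open import Data.Product using (∃)
open import Relation.Binary.PropositionalEquality using (_≡_)
open import Relation.Nullary.Decidable using (⌊_⌋)

all : {A : Set} → (A → Bool) → List A → Bool
all p = foldr (λ x b → p x ∧ b) true

any : {A : Set} → (A → Bool) → List A → Bool
any p = foldr (λ x b → p x ∨ b) false

sumFin : (n : ℕ) → (Fin n → ℕ) → ℕ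
sumFin n f = sum (map f (allFin n))

_==ᶠ_ : {n : ℕ} → Fin n → Fin n → Bool
i ==ᶠ j = ⌊ i ≟ᶠ j ⌋

allVecs : (m : ℕ) → List (Vec Bool m)
allVecs zero = [] ∷ []
allVecs (suc m) = map (true ∷_) (allVecs m) ++ map (false ∷_) (allVecs m)

-- A graph is encoded by a Boolean vector of length n*n; the edge {i,j}
-- (i ≠ j) is present iff the entry at position (min i j, max i j) is true.
-- Entries at other positions are irrelevant. Under the uniform measure on
-- Vec Bool (n*n), each of the (n choose 2) potential edges is present
-- independently with probability 1/2, i.e. we get G(n,1/2); hence the
-- probability of an event E equals  count E / 2^(n*n).

record Graph (n : ℕ) : Set where
  constructor mkGraph
  field bits : Vec Bool (n * n)
open Graph public

adj : {n : ℕ} → Graph n → Fin n → Fin n → Bool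
adj G i j = if toℕ i <ᵇ toℕ j then lookup (bits G) (combine i j) else lookup (bits G) (combine j i)

count : {n : ℕ} → (Graph n → Bool) → ℕ
count {n} E = length (filter (λ G → T? (E G)) (map mkGraph (allVecs (n * n))))
  where
    open import Relation.Nullary using (Dec; yes; no)
    open import Data.Unit using (tt)
    T? : (b : Bool) → Dec (T b)
    T? true = yes tt
    T? false = no (λ ())

-- Ordered partitions of [n] into k nonempty parts V_0,...,V_{k-1}
-- (indices shifted by one w.r.t. the paper), |V_0| ≥ ... ≥ |V_{k-1}|.

partSize : {n k : ℕ} → (Fin n → Fin k) → Fin k → ℕ
partSize {n} p j = length (filter (λ v → p v Data.Fin.≟ j) (allFin n))

record OrdPartition (n k : ℕ) : Set where
  field
    part     : Fin n → Fin k
    nonempty : (j : Fin k) → ∃ λ v → part v ≡ j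
    sorted   : (i j : Fin k) → toℕ i ≤ toℕ j → partSize part j ≤ partSize part i

open OrdPartition public

size : {n k : ℕ} → OrdPartition n k → Fin k → ℕ
size π = partSize (part π)

-- A profile (k_u)_{1 ≤ u ≤ n} is a function Fin n → ℕ, where index u
-- corresponds to size toℕ u + 1.
isKProfile : (n k : ℕ) → (Fin n → ℕ) → Set
isKProfile n k kp = sumFin n kp ≡ k

isComplete : (n : ℕ) → (Fin n → ℕ) → Set
isComplete n kp = sumFin n (λ u → suc (toℕ u) * kp u) ≡ n

k₁≡0 : (n : ℕ) → (Fin n → ℕ) → Set
k₁≡0 n kp = (u : Fin n) → toℕ u ≡ 0 → kp u ≡ 0

HasProfile : {n k : ℕ} → OrdPartition n k → (Fin n → ℕ) → Set
HasProfile {n} {k} π kp =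
  (u : Fin n) → length (filter (λ j → size π j Data.Nat.≟ suc (toℕ u)) (allFin k)) ≡ kp u

samePart : {n k k' : ℕ} → OrdPartition n k → OrdPartition n k' → Fin k → Fin k' → Bool
samePart {n} π π' j j' = all (λ v → not ((part π v ==ᶠ j) Data.Bool.xor (part π' v ==ᶠ j'))) (allFin n)

commonParts : {n k k' : ℕ} → OrdPartition n k → OrdPartition n k' → ℕ
commonParts {n} {k} {k'} π π' =
  length (filter (λ j → T?' (any (samePart π π' j) (allFin k'))) (allFin k))
  where
    open import Relation.Nullary using (Dec; yes; no)
    open import Data.Unit using (tt)
    T?' : (b : Bool) → Dec (T b)
    T?' true = yes tt
    T?' false = no (λ ())

partIndep : {n k : ℕ} → OrdPartition n k → Graph n → Fin k → Bool
partIndep {n} π G j = all (λ u → all (λ v →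
  not ((toℕ u <ᵇ toℕ v) ∧ (part π u ==ᶠ j) ∧ (part π v ==ᶠ j)) ∨ not (adj G u v)) (allFin n)) (allFin n)

partClique : {n k : ℕ} → OrdPartition n k → Graph n → Fin k → Bool
partClique {n} π G j = all (λ u → all (λ v →
  not ((toℕ u <ᵇ toℕ v) ∧ (part π u ==ᶠ j) ∧ (part π v ==ᶠ j)) ∨ adj G u v) (allFin n)) (allFin n)

A : {n k : ℕ} → OrdPartition n k → Graph n → Bool
A {k = k} π G = all (partIndep π G) (allFin k)

Aco : {n k : ℕ} → OrdPartition n k → Graph n → Bool
Aco {k = k} π G = all (λ j → partIndep π G j ∨ partClique π G j) (allFin k)

-- Flipping every edge inside the parts V_j with σ_j = 1, for σ ∈ {0,1}^k, is a measure-preserving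
-- bijection of G(n,1/2). When all parts have at least two vertices, a cocolouring π of G determines
-- exactly one σ (its clique parts) for which the flipped graph is properly coloured by π; averaging
-- over σ gives P(A^co_π) = 2^k P(A_π).
-- For two partitions, flip the clique parts of π and of π′ at once, indexing the flips by a vector
-- σ′ for π′ and a vector ρ for π. Taking σ′ and ρ to be the clique patterns of G, the flipped graph
-- is coloured by both π and π′; since ρ is ignored on the ℓ common parts, 2^ℓ choices of ρ work.
-- Averaging over (σ′, ρ) gives 2^ℓ P(A^co_π ∩ A^co_π′) ≤ 2^(2k) P(A_π ∩ A_π′).

module Submission where

open import Defs
open import Algebra.Properties.CommutativeSemigroup using (interchange)
open import Data.Bool using (Bool; true; false; T; not; _∧_; _∨_; _xor_; if_then_else_)
import Data.Bool.ListAction as ListAction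
open import Data.Bool.Properties
  using (T-≡; T-not-≡; T-∧; ∨-comm; ∨-identityʳ; ∨-idem) renaming (_≟_ to _≟ᵇ_)
open import Data.Empty using (⊥; ⊥-elim)
open import Data.Fin as Fin using (Fin; zero; suc; toℕ; combine; remQuot)
open import Data.Fin.Properties using (toℕ-injective; remQuot-combine)
open import Data.List using (List; []; _∷_; _++_; map; filter; length; tabulate; allFin)
open import Data.List.Membership.Propositional using (_∈_)
open import Data.List.Membership.Propositional.Properties using (∈-allFin; ∈-filter⁺; ∈-filter⁻)
open import Data.List.Properties using (map-++; map-∘; map-cong; map-tabulate; foldr-map)
open import Data.List.Relation.Unary.All as All using (_∷_)
open import Data.List.Relation.Unary.All.Properties using (all⁺; all⁻; tabulate⁺)
open import Data.List.Relation.Unary.Any using (here; there; satisfied)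
open import Data.List.Relation.Unary.Any.Properties using (any⁻)
open import Data.List.Relation.Unary.AllPairs using (_∷_)
open import Data.List.Relation.Unary.Unique.Propositional using (Unique)
open import Data.List.Relation.Unary.Unique.Propositional.Properties using (allFin⁺; filter⁺)
open import Data.Nat using (ℕ; zero; suc; _+_; _*_; _∸_; _^_; _≤_; _<_; _<ᵇ_; z≤n; s≤s; _≟_)
open import Data.Nat.ListAction using (sum; product)
open import Data.Nat.ListAction.Properties using (sum-++)
open import Data.Nat.Properties
  using ( +-comm; +-identityʳ; *-identityˡ; *-identityʳ; *-zeroʳ; *-assoc; *-distribˡ-+; *-distribʳ-+
        ; ^-distribˡ-+-*; m+[n∸m]≡n; m^n≢0; +-commutativeSemigroup
        ; module ≤-Reasoning; ≤-refl; ≤-trans; m≤m+n; m≤n+m; +-mono-≤; *-cancelˡ-≤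
        ; <-irrefl; <-cmp; ≤∧≢⇒<; <ᵇ⇒<; <⇒<ᵇ)
open import Data.Product using (_×_; ∃; ∃₂; _,_; proj₁; proj₂; uncurry)
open import Data.Vec as Vec using (Vec; []; _∷_; lookup; zipWith)
open import Data.Vec.Properties using (lookup-zipWith; lookup∘tabulate)
open import Function using (_∘_; id; const; _⇔_; mk⇔; Equivalence)
open Equivalence using (to; from)
open import Function.Properties.Equivalence using () renaming (trans to ⇔-trans; sym to ⇔-sym)
open import Relation.Binary using (tri<; tri≈; tri>)
open import Relation.Binary.PropositionalEquality
  using (_≡_; _≢_; refl; sym; trans; cong; cong₂; subst; module ≡-Reasoning)
open import Relation.Nullary using (Dec; yes; no; ¬_)
open import Relation.Nullary.Decidable using (⌊_⌋; toWitness; fromWitness)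

𝟙 : Bool → ℕ
𝟙 true  = 1
𝟙 false = 0

𝟙-∧ : ∀ a b → 𝟙 (a ∧ b) ≡ 𝟙 a * 𝟙 b
𝟙-∧ true  b = sym (*-identityˡ (𝟙 b))
𝟙-∧ false b = refl

𝟙-∨ : ∀ a b → ¬ (T a × T b) → 𝟙 (a ∨ b) ≡ 𝟙 a + 𝟙 b
𝟙-∨ true  true  a∧b = ⊥-elim (a∧b (_ , _))
𝟙-∨ true  false _   = refl
𝟙-∨ false b     _   = refl

𝟙-mono : ∀ {a b} → (T a → T b) → 𝟙 a ≤ 𝟙 b
𝟙-mono {false}         _   = z≤n
𝟙-mono {true}  {true}  _   = ≤-refl
𝟙-mono {true}  {false} a⇒b = ⊥-elim (a⇒b _)

*-𝟙-≤ : ∀ {c r} b → (T b → c ≤ r) → c * 𝟙 b ≤ r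
*-𝟙-≤ {c} {r} true  b⇒c≤r = subst (_≤ r) (sym (*-identityʳ c)) (b⇒c≤r _)
*-𝟙-≤ {c} {r} false _     = subst (_≤ r) (sym (*-zeroʳ c)) z≤n

private variable
  X Y : Set

sum-map-cong : ∀ {f g : X → ℕ} → (∀ x → f x ≡ g x) → ∀ xs → sum (map f xs) ≡ sum (map g xs)
sum-map-cong f≗g xs = cong sum (map-cong f≗g xs)

sum-map-mono : ∀ {f g : X → ℕ} → (∀ x → f x ≤ g x) → ∀ xs → sum (map f xs) ≤ sum (map g xs)
sum-map-mono f≤g []       = z≤n
sum-map-mono f≤g (x ∷ xs) = +-mono-≤ (f≤g x) (sum-map-mono f≤g xs)

sum-map-const : ∀ c (xs : List X) → sum (map (λ _ → c) xs) ≡ length xs * c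
sum-map-const c []       = refl
sum-map-const c (x ∷ xs) = cong (c +_) (sum-map-const c xs)

sum-map-*ˡ : ∀ c (f : X → ℕ) xs → sum (map (λ x → c * f x) xs) ≡ c * sum (map f xs)
sum-map-*ˡ c f []       = sym (*-zeroʳ c)
sum-map-*ˡ c f (x ∷ xs) = trans (cong (c * f x +_) (sum-map-*ˡ c f xs)) (sym (*-distribˡ-+ c (f x) _))

sum-map-+ : ∀ (f g : X → ℕ) xs → sum (map (λ x → f x + g x) xs) ≡ sum (map f xs) + sum (map g xs)
sum-map-+ f g []       = refl
sum-map-+ f g (x ∷ xs) =
  trans (cong (f x + g x +_) (sum-map-+ f g xs)) (interchange +-commutativeSemigroup (f x) (g x) _ _)

sum-map-++ : ∀ (f : X → ℕ) xs ys → sum (map f (xs ++ ys)) ≡ sum (map f xs) + sum (map f ys)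
sum-map-++ f xs ys = trans (cong sum (map-++ f xs ys)) (sum-++ (map f xs) (map f ys))

sum-map-swap : ∀ (f : X → Y → ℕ) (xs : List X) (ys : List Y) →
  sum (map (λ x → sum (map (f x) ys)) xs) ≡ sum (map (λ y → sum (map (λ x → f x y) xs)) ys)
sum-map-swap f []       ys = sym (trans (sum-map-const 0 ys) (*-zeroʳ (length ys)))
sum-map-swap f (x ∷ xs) ys = trans (cong (sum (map (f x) ys) +_) (sum-map-swap f xs ys))
                                   (sym (sum-map-+ (f x) (λ y → sum (map (λ x → f x y) xs)) ys))

length-filter-T : ∀ (f : X → Bool) (P? : ∀ x → Dec (T (f x))) xs →
  length (filter P? xs) ≡ sum (map (𝟙 ∘ f) xs)
length-filter-T f P? []       = refl
length-filter-T f P? (x ∷ xs) with f x | P? x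
... | true  | yes _ = cong suc (length-filter-T f P? xs)
... | true  | no ¬t = ⊥-elim (¬t _)
... | false | no _  = length-filter-T f P? xs

map-allFin-suc : ∀ {k} (f : Fin (suc k) → X) → map f (allFin (suc k)) ≡ f zero ∷ map (f ∘ suc) (allFin k)
map-allFin-suc f = cong (f zero ∷_) (trans (map-tabulate suc f) (sym (map-tabulate id (f ∘ suc))))

sumFin-suc : ∀ k (f : Fin (suc k) → ℕ) → sumFin (suc k) f ≡ f zero + sumFin k (f ∘ suc)
sumFin-suc k f = cong sum (map-allFin-suc f)

prodFin : (k : ℕ) → (Fin k → ℕ) → ℕ
prodFin k f = product (map f (allFin k))

prodFin-suc : ∀ k (f : Fin (suc k) → ℕ) → prodFin (suc k) f ≡ f zero * prodFin k (f ∘ suc)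
prodFin-suc k f = cong product (map-allFin-suc f)

prodFin-cong : ∀ k {f g : Fin k → ℕ} → (∀ j → f j ≡ g j) → prodFin k f ≡ prodFin k g
prodFin-cong k f≗g = cong product (map-cong f≗g (allFin k))

prodFin-2^ : ∀ k (b : Fin k → Bool) → prodFin k (λ j → if b j then 2 else 1) ≡ 2 ^ sumFin k (𝟙 ∘ b)
prodFin-2^ zero    b = refl
prodFin-2^ (suc k) b = begin
  prodFin (suc k) (λ j → if b j then 2 else 1)
    ≡⟨ prodFin-suc k (λ j → if b j then 2 else 1) ⟩
  (if b zero then 2 else 1) * prodFin k (λ j → if b (suc j) then 2 else 1)
    ≡⟨ cong ((if b zero then 2 else 1) *_) (prodFin-2^ k (b ∘ suc)) ⟩
  (if b zero then 2 else 1) * 2 ^ sumFin k (𝟙 ∘ b ∘ suc)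
    ≡⟨ factor (b zero) ⟩
  2 ^ (𝟙 (b zero) + sumFin k (𝟙 ∘ b ∘ suc))
    ≡⟨ cong (2 ^_) (sym (sumFin-suc k (𝟙 ∘ b))) ⟩
  2 ^ sumFin (suc k) (𝟙 ∘ b) ∎
  where
  open ≡-Reasoning
  factor : ∀ c {e} → (if c then 2 else 1) * 2 ^ e ≡ 2 ^ (𝟙 c + e)
  factor true  = refl
  factor false = +-identityʳ _

𝟙-all-tabulate : ∀ {k} (p : X → Bool) (g : Fin k → X) → 𝟙 (all p (tabulate g)) ≡ prodFin k (𝟙 ∘ p ∘ g)
𝟙-all-tabulate {k = zero}  p g = refl
𝟙-all-tabulate {k = suc k} p g = begin
  𝟙 (p (g zero) ∧ all p (tabulate (g ∘ suc)))     ≡⟨ 𝟙-∧ (p (g zero)) _ ⟩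
  𝟙 (p (g zero)) * 𝟙 (all p (tabulate (g ∘ suc))) ≡⟨ cong (𝟙 (p (g zero)) *_) (𝟙-all-tabulate p (g ∘ suc)) ⟩
  𝟙 (p (g zero)) * prodFin k (𝟙 ∘ p ∘ g ∘ suc)     ≡⟨ sym (prodFin-suc k (𝟙 ∘ p ∘ g)) ⟩
  prodFin (suc k) (𝟙 ∘ p ∘ g)                      ∎
  where open ≡-Reasoning

𝟙-all-allFin : ∀ {k} (p : Fin k → Bool) → 𝟙 (all p (allFin k)) ≡ prodFin k (𝟙 ∘ p)
𝟙-all-allFin p = 𝟙-all-tabulate p id

T-all-allFin : ∀ {k} (p : Fin k → Bool) → T (all p (allFin k)) ⇔ (∀ j → T (p j))
T-all-allFin {k} p = mk⇔
  (λ t j → All.lookup (all⁺ p (allFin k) (subst T (sym all≡) t)) (∈-allFin j))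
  (λ h → subst T all≡ (all⁻ p (tabulate⁺ h)))
  where
  all≡ : ListAction.all p (allFin k) ≡ all p (allFin k)
  all≡ = foldr-map _∧_ p true (allFin k)

T-any⇒∃ : ∀ (p : X → Bool) xs → T (any p xs) → ∃ (T ∘ p)
T-any⇒∃ p xs t = satisfied (any⁻ p xs (subst T (sym (foldr-map _∨_ p false xs)) t))

all-cong : ∀ {p q : X → Bool} → (∀ x → p x ≡ q x) → ∀ xs → all p xs ≡ all q xs
all-cong p≗q []       = refl
all-cong p≗q (x ∷ xs) = cong₂ _∧_ (p≗q x) (all-cong p≗q xs)

T-==ᶠ : ∀ {k} {i j : Fin k} → T (i ==ᶠ j) ⇔ i ≡ j
T-==ᶠ {i = i} {j} = mk⇔ (toWitness {a? = i Fin.≟ j}) fromWitness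

T-injective : ∀ {a b} → T a ⇔ T b → a ≡ b
T-injective {true}  {true}  _ = refl
T-injective {true}  {false} h = ⊥-elim (to h _)
T-injective {false} {true}  h = ⊥-elim (from h _)
T-injective {false} {false} _ = refl

T-¬∨ : ∀ {a b} → T (not a ∨ b) ⇔ (T a → T b)
T-¬∨ {true}  = mk⇔ (λ t _ → t) (λ f → f _)
T-¬∨ {false} = mk⇔ (λ _ ()) _

T-¬xor : ∀ {a b} → T (not (a xor b)) → a ≡ b
T-¬xor {true}  {true}  _ = refl
T-¬xor {false} {false} _ = refl

xor≡false⇔≡ : ∀ {c a} → c xor a ≡ false ⇔ a ≡ c
xor≡false⇔≡ {false} {false} = mk⇔ (const refl) (const refl)
xor≡false⇔≡ {false} {true}  = mk⇔ (λ ()) (λ ())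
xor≡false⇔≡ {true}  {false} = mk⇔ (λ ()) (λ ())
xor≡false⇔≡ {true}  {true}  = mk⇔ (const refl) (const refl)

∨-∧-absorb : ∀ a b x → (T b → x ≡ a) → a ∨ (b ∧ x) ≡ a
∨-∧-absorb a true  x x≡a = trans (cong (a ∨_) (x≡a _)) (∨-idem a)
∨-∧-absorb a false x _   = ∨-identityʳ a

sumVecs : (m : ℕ) → (Vec Bool m → ℕ) → ℕ
sumVecs m h = sum (map h (allVecs m))

sumVecs-suc : ∀ m (h : Vec Bool (suc m) → ℕ) →
  sumVecs (suc m) h ≡ sumVecs m (h ∘ (true ∷_)) + sumVecs m (h ∘ (false ∷_))
sumVecs-suc m h = trans (sum-map-++ h (map (true ∷_) (allVecs m)) (map (false ∷_) (allVecs m)))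
                        (cong₂ _+_ (cong sum (sym (map-∘ (allVecs m)))) (cong sum (sym (map-∘ (allVecs m)))))

sumVecs-cong : ∀ m {f g : Vec Bool m → ℕ} → (∀ σ → f σ ≡ g σ) → sumVecs m f ≡ sumVecs m g
sumVecs-cong m f≗g = sum-map-cong f≗g (allVecs m)

sumVecs-mono : ∀ m {f g : Vec Bool m → ℕ} → (∀ σ → f σ ≤ g σ) → sumVecs m f ≤ sumVecs m g
sumVecs-mono m f≤g = sum-map-mono f≤g (allVecs m)

sumVecs-const : ∀ m c → sumVecs m (λ _ → c) ≡ 2 ^ m * c
sumVecs-const zero    c = refl
sumVecs-const (suc m) c = begin
  sumVecs (suc m) (λ _ → c)                  ≡⟨ sumVecs-suc m (λ _ → c) ⟩
  sumVecs m (λ _ → c) + sumVecs m (λ _ → c)  ≡⟨ cong₂ _+_ (sumVecs-const m c) (sumVecs-const m c) ⟩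
  2 ^ m * c + 2 ^ m * c                      ≡⟨ cong (2 ^ m * c +_) (sym (+-identityʳ (2 ^ m * c))) ⟩
  2 * (2 ^ m * c)                            ≡⟨ sym (*-assoc 2 (2 ^ m) c) ⟩
  2 ^ suc m * c                              ∎
  where open ≡-Reasoning

sumVecs-term : ∀ m (h : Vec Bool m → ℕ) σ → h σ ≤ sumVecs m h
sumVecs-term zero    h []      = m≤m+n (h []) 0
sumVecs-term (suc m) h (b ∷ σ) rewrite sumVecs-suc m h with b
... | true  = ≤-trans (sumVecs-term m (h ∘ (true ∷_)) σ) (m≤m+n _ _)
... | false = ≤-trans (sumVecs-term m (h ∘ (false ∷_)) σ) (m≤n+m _ _)

sumVecs-xor : ∀ m (c : Vec Bool m) (h : Vec Bool m → ℕ) → sumVecs m (h ∘ zipWith _xor_ c) ≡ sumVecs m h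
sumVecs-xor zero    []      h = refl
sumVecs-xor (suc m) (b ∷ c) h = begin
  sumVecs (suc m) (h ∘ zipWith _xor_ (b ∷ c))
    ≡⟨ sumVecs-suc m _ ⟩
  sumVecs m (h ∘ ((b xor true) ∷_) ∘ zipWith _xor_ c) + sumVecs m (h ∘ ((b xor false) ∷_) ∘ zipWith _xor_ c)
    ≡⟨ cong₂ _+_ (sumVecs-xor m c (h ∘ ((b xor true) ∷_))) (sumVecs-xor m c (h ∘ ((b xor false) ∷_))) ⟩
  sumVecs m (h ∘ ((b xor true) ∷_)) + sumVecs m (h ∘ ((b xor false) ∷_))
    ≡⟨ halves b ⟩
  sumVecs m (h ∘ (true ∷_)) + sumVecs m (h ∘ (false ∷_))
    ≡⟨ sym (sumVecs-suc m h) ⟩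
  sumVecs (suc m) h ∎
  where
  open ≡-Reasoning
  halves : ∀ b → sumVecs m (h ∘ ((b xor true) ∷_)) + sumVecs m (h ∘ ((b xor false) ∷_))
               ≡ sumVecs m (h ∘ (true ∷_)) + sumVecs m (h ∘ (false ∷_))
  halves true  = +-comm (sumVecs m (h ∘ (false ∷_))) (sumVecs m (h ∘ (true ∷_)))
  halves false = refl

sumVecs-prodFin : ∀ k (f : Fin k → Bool → ℕ) →
  sumVecs k (λ σ → prodFin k (λ j → f j (lookup σ j))) ≡ prodFin k (λ j → f j true + f j false)
sumVecs-prodFin zero    f = refl
sumVecs-prodFin (suc k) f = begin
  sumVecs (suc k) (λ σ → prodFin (suc k) (λ j → f j (lookup σ j)))
    ≡⟨ sumVecs-suc k _ ⟩
  sumVecs k (λ σ → prodFin (suc k) (λ j → f j (lookup (true ∷ σ) j)))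
    + sumVecs k (λ σ → prodFin (suc k) (λ j → f j (lookup (false ∷ σ) j)))
    ≡⟨ cong₂ _+_ (sumVecs-cong k (λ σ → prodFin-suc k (λ j → f j (lookup (true ∷ σ) j))))
                 (sumVecs-cong k (λ σ → prodFin-suc k (λ j → f j (lookup (false ∷ σ) j)))) ⟩
  sumVecs k (λ σ → f zero true * rest σ) + sumVecs k (λ σ → f zero false * rest σ)
    ≡⟨ cong₂ _+_ (sum-map-*ˡ (f zero true) rest (allVecs k)) (sum-map-*ˡ (f zero false) rest (allVecs k)) ⟩
  f zero true * sumVecs k rest + f zero false * sumVecs k rest
    ≡⟨ sym (*-distribʳ-+ (sumVecs k rest) (f zero true) (f zero false)) ⟩
  (f zero true + f zero false) * sumVecs k rest
    ≡⟨ cong ((f zero true + f zero false) *_) (sumVecs-prodFin k (f ∘ suc)) ⟩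
  (f zero true + f zero false) * prodFin k (λ j → f (suc j) true + f (suc j) false)
    ≡⟨ sym (prodFin-suc k (λ j → f j true + f j false)) ⟩
  prodFin (suc k) (λ j → f j true + f j false) ∎
  where
  open ≡-Reasoning
  rest : Vec Bool k → ℕ
  rest σ = prodFin k (λ j → f (suc j) (lookup σ j))

agreesOff : ∀ {k} → (Fin k → Bool) → (Fin k → Bool) → Vec Bool k → Bool
agreesOff {k} free c ρ = all (λ j → free j ∨ ⌊ lookup ρ j ≟ᵇ c j ⌋) (allFin k)

sumVecs-agreesOff : ∀ k (free c : Fin k → Bool) → sumVecs k (𝟙 ∘ agreesOff free c) ≡ 2 ^ sumFin k (𝟙 ∘ free)
sumVecs-agreesOff k free c = begin
  sumVecs k (𝟙 ∘ agreesOff free c)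
    ≡⟨ sumVecs-cong k (λ ρ → 𝟙-all-allFin (λ j → free j ∨ ⌊ lookup ρ j ≟ᵇ c j ⌋)) ⟩
  sumVecs k (λ ρ → prodFin k (λ j → 𝟙 (free j ∨ ⌊ lookup ρ j ≟ᵇ c j ⌋)))
    ≡⟨ sumVecs-prodFin k (λ j b → 𝟙 (free j ∨ ⌊ b ≟ᵇ c j ⌋)) ⟩
  prodFin k (λ j → 𝟙 (free j ∨ ⌊ true ≟ᵇ c j ⌋) + 𝟙 (free j ∨ ⌊ false ≟ᵇ c j ⌋))
    ≡⟨ prodFin-cong k (λ j → choices (free j) (c j)) ⟩
  prodFin k (λ j → if free j then 2 else 1)
    ≡⟨ prodFin-2^ k free ⟩
  2 ^ sumFin k (𝟙 ∘ free) ∎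
  where
  open ≡-Reasoning
  choices : ∀ f b → 𝟙 (f ∨ ⌊ true ≟ᵇ b ⌋) + 𝟙 (f ∨ ⌊ false ≟ᵇ b ⌋) ≡ (if f then 2 else 1)
  choices true  _     = refl
  choices false true  = refl
  choices false false = refl

agreesOff⇒≡ : ∀ {k} {free c : Fin k → Bool} {ρ} → T (agreesOff free c ρ) → ∀ j → free j ≡ false → lookup ρ j ≡ c j
agreesOff⇒≡ agree j fixed = toWitness (subst (λ f → T (f ∨ _)) fixed (to (T-all-allFin _) agree j))

-- Graphs and edge flips

module _ {n : ℕ} where

  sumGraphs : (Graph n → ℕ) → ℕ
  sumGraphs h = sumVecs (n * n) (h ∘ mkGraph)

  count≡sumGraphs : (E : Graph n → Bool) → count E ≡ sumGraphs (𝟙 ∘ E)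
  count≡sumGraphs E = begin
    count E                   ≡⟨ length-filter-T E _ graphs ⟩
    sum (map (𝟙 ∘ E) graphs)  ≡⟨ cong sum (sym (map-∘ (allVecs (n * n)))) ⟩
    sumGraphs (𝟙 ∘ E)         ∎
    where
    open ≡-Reasoning
    graphs = map mkGraph (allVecs (n * n))

  edgeBits : (Fin n → Fin n → Bool) → Vec Bool (n * n)
  edgeBits μ = Vec.tabulate (uncurry μ ∘ remQuot n)

  flipEdges : (Fin n → Fin n → Bool) → Graph n → Graph n
  flipEdges μ G = mkGraph (zipWith _xor_ (edgeBits μ) (bits G))

  adj-flipEdges : ∀ μ G {u v} → toℕ u < toℕ v → adj (flipEdges μ G) u v ≡ μ u v xor adj G u v
  adj-flipEdges μ G {u} {v} u<v rewrite to T-≡ (<⇒<ᵇ u<v) = begin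
    lookup (zipWith _xor_ (edgeBits μ) (bits G)) uv
      ≡⟨ lookup-zipWith _xor_ uv (edgeBits μ) (bits G) ⟩
    lookup (edgeBits μ) uv xor lookup (bits G) uv
      ≡⟨ cong (_xor lookup (bits G) uv) (lookup∘tabulate (uncurry μ ∘ remQuot n) uv) ⟩
    uncurry μ (remQuot n uv) xor lookup (bits G) uv
      ≡⟨ cong (λ p → uncurry μ p xor lookup (bits G) uv) (remQuot-combine u v) ⟩
    μ u v xor lookup (bits G) uv ∎
    where
    open ≡-Reasoning
    uv = combine u v

  sumGraphs-flipEdges : ∀ μ (h : Graph n → ℕ) → sumGraphs (h ∘ flipEdges μ) ≡ sumGraphs h
  sumGraphs-flipEdges μ h = sumVecs-xor (n * n) (edgeBits μ) (h ∘ mkGraph)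

  sumGraphs-average : ∀ m (M : Vec Bool m → Fin n → Fin n → Bool) (h : Graph n → ℕ) →
    sumGraphs (λ G → sumVecs m (λ σ → h (flipEdges (M σ) G))) ≡ 2 ^ m * sumGraphs h
  sumGraphs-average m M h = begin
    sumGraphs (λ G → sumVecs m (λ σ → h (flipEdges (M σ) G)))
      ≡⟨ sum-map-swap (λ b σ → h (flipEdges (M σ) (mkGraph b))) (allVecs (n * n)) (allVecs m) ⟩
    sumVecs m (λ σ → sumGraphs (h ∘ flipEdges (M σ)))
      ≡⟨ sumVecs-cong m (λ σ → sumGraphs-flipEdges (M σ) h) ⟩
    sumVecs m (λ _ → sumGraphs h)
      ≡⟨ sumVecs-const m (sumGraphs h) ⟩
    2 ^ m * sumGraphs h ∎
    where open ≡-Reasoning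

module _ {n k : ℕ} (π : OrdPartition n k) where

  PairIn : Fin k → Fin n → Fin n → Set
  PairIn j u v = toℕ u < toℕ v × part π u ≡ j × part π v ≡ j

  Uniform : Graph n → Fin k → Bool → Set
  Uniform G j b = ∀ u v → PairIn j u v → adj G u v ≡ b

  T-pairIn : ∀ j u v → T ((toℕ u <ᵇ toℕ v) ∧ (part π u ==ᶠ j) ∧ (part π v ==ᶠ j)) ⇔ PairIn j u v
  T-pairIn j u v = mk⇔
    (λ t → let u<v , uv∈j = to (T-∧ {toℕ u <ᵇ toℕ v}) t
               u∈j , v∈j  = to (T-∧ {part π u ==ᶠ j}) uv∈j
           in <ᵇ⇒< (toℕ u) (toℕ v) u<v , to T-==ᶠ u∈j , to T-==ᶠ v∈j)
    (λ (u<v , u∈j , v∈j) → from T-∧ (<⇒<ᵇ u<v , from T-∧ (from T-==ᶠ u∈j , from T-==ᶠ v∈j)))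

  -- partIndep and partClique are this conjunction with f = not and f = id respectively.
  T-pairwise : ∀ G j (f : Bool → Bool) →
    T (all (λ u → all (λ v → not ((toℕ u <ᵇ toℕ v) ∧ (part π u ==ᶠ j) ∧ (part π v ==ᶠ j)) ∨ f (adj G u v))
                      (allFin n))
           (allFin n))
    ⇔ (∀ u v → PairIn j u v → T (f (adj G u v)))
  T-pairwise G j f = mk⇔
    (λ t u v → to T-¬∨ (to (T-all-allFin _) (to (T-all-allFin _) t u) v) ∘ from (T-pairIn j u v))
    (λ h → from (T-all-allFin _) λ u → from (T-all-allFin _) λ v → from T-¬∨ (h u v ∘ to (T-pairIn j u v)))

  partUniform : Graph n → Fin k → Bool → Bool
  partUniform G j b = if b then partClique π G j else partIndep π G j

  T-partUniform : ∀ G j b → T (partUniform G j b) ⇔ Uniform G j b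
  T-partUniform G j true  = mk⇔
    (λ t u v → to T-≡ ∘ to (T-pairwise G j id) t u v)
    (λ h → from (T-pairwise G j id) λ u v → from T-≡ ∘ h u v)
  T-partUniform G j false = mk⇔
    (λ t u v → to T-not-≡ ∘ to (T-pairwise G j not) t u v)
    (λ h → from (T-pairwise G j not) λ u v → from T-not-≡ ∘ h u v)

  Uniform-flipEdges : ∀ μ G {j c} → (∀ u v → PairIn j u v → μ u v ≡ c) →
    Uniform (flipEdges μ G) j false ⇔ Uniform G j c
  Uniform-flipEdges μ G {j} {c} μ≡c = mk⇔
    (λ h u v uv∈j → to xor≡false⇔≡ (trans (sym (adj≡ u v uv∈j)) (h u v uv∈j)))
    (λ h u v uv∈j → trans (adj≡ u v uv∈j) (from xor≡false⇔≡ (h u v uv∈j)))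
    where
    adj≡ : ∀ u v → PairIn j u v → adj (flipEdges μ G) u v ≡ c xor adj G u v
    adj≡ u v uv∈j@(u<v , _) = trans (adj-flipEdges μ G u<v) (cong (_xor adj G u v) (μ≡c u v uv∈j))

  2≤size⇒pairIn : ∀ j → 2 ≤ size π j → ∃₂ (PairIn j)
  2≤size⇒pairIn j = twoMembers (filter V_j? (allFin n)) (filter⁺ V_j? (allFin⁺ n))
                                (λ v∈ → proj₂ (∈-filter⁻ V_j? {xs = allFin n} v∈))
    where
    V_j? : ∀ v → Dec (part π v ≡ j)
    V_j? v = part π v Fin.≟ j
    twoMembers : ∀ xs → Unique xs → (∀ {v} → v ∈ xs → part π v ≡ j) → 2 ≤ length xs → ∃₂ (PairIn j)
    twoMembers (u ∷ v ∷ _) ((u≢v ∷ _) ∷ _) ∈V_j _ with <-cmp (toℕ u) (toℕ v)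
    ... | tri< u<v _ _ = u , v , u<v , ∈V_j (here refl) , ∈V_j (there (here refl))
    ... | tri≈ _ u≡v _ = ⊥-elim (u≢v (toℕ-injective u≡v))
    ... | tri> _ _ v<u = v , u , v<u , ∈V_j (there (here refl)) , ∈V_j (here refl)
    twoMembers (_ ∷ []) _ _ (s≤s ())

  Uniform-unique : ∀ G {j} → 2 ≤ size π j → Uniform G j false → Uniform G j true → ⊥
  Uniform-unique G 2≤size indep clique with u , v , uv∈j ← 2≤size⇒pairIn _ 2≤size
    with () ← trans (sym (indep u v uv∈j)) (clique u v uv∈j)

∈⇒1≤length : ∀ {x : X} {xs} → x ∈ xs → 1 ≤ length xs
∈⇒1≤length {xs = _ ∷ _} _ = s≤s z≤n

k₁≡0⇒2≤size : ∀ {n k} (kp : Fin n → ℕ) (π : OrdPartition n k) → k₁≡0 n kp → HasProfile π kp →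
  ∀ j → 2 ≤ size π j
k₁≡0⇒2≤size {zero}  kp π _    _       j with () ← proj₁ (nonempty π j)
k₁≡0⇒2≤size {suc n} kp π k₁≡0 profile j = ≤∧≢⇒< 1≤size 1≢size
  where
  1≤size : 1 ≤ size π j
  1≤size = ∈⇒1≤length (∈-filter⁺ (λ v → part π v Fin.≟ j) (∈-allFin (proj₁ (nonempty π j))) (proj₂ (nonempty π j)))
  1≢size : 1 ≢ size π j
  1≢size 1≡size = <-irrefl refl (subst (1 ≤_) (trans (profile zero) (k₁≡0 zero refl))
    (∈⇒1≤length (∈-filter⁺ (λ j′ → size π j′ ≟ 1) (∈-allFin j) (sym 1≡size))))

-- One partition

module _ {n k : ℕ} (π : OrdPartition n k) where

  partMask : (Fin k → Bool) → Fin n → Fin n → Bool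
  partMask c u v = (part π u ==ᶠ part π v) ∧ c (part π u)

  partMask-pairIn : ∀ c j u v → PairIn π j u v → partMask c u v ≡ c j
  partMask-pairIn c j u v (_ , u∈j , v∈j) rewrite u∈j | v∈j = cong (_∧ c j) (to T-≡ (from T-==ᶠ refl))

  partIndep-flipEdges : ∀ σ G j →
    partIndep π (flipEdges (partMask (lookup σ)) G) j ≡ partUniform π G j (lookup σ j)
  partIndep-flipEdges σ G j = T-injective (⇔-trans (T-partUniform π (flipEdges μ G) j false)
    (⇔-trans (Uniform-flipEdges π μ G (partMask-pairIn (lookup σ) j)) (⇔-sym (T-partUniform π G j (lookup σ j)))))
    where μ = partMask (lookup σ)

  𝟙-Aco : (∀ j → 2 ≤ size π j) → ∀ G →
    𝟙 (Aco π G) ≡ sumVecs k (λ σ → 𝟙 (A π (flipEdges (partMask (lookup σ)) G)))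
  𝟙-Aco nontrivial G = begin
    𝟙 (Aco π G)
      ≡⟨ 𝟙-all-allFin (λ j → partIndep π G j ∨ partClique π G j) ⟩
    prodFin k (λ j → 𝟙 (partIndep π G j ∨ partClique π G j))
      ≡⟨ prodFin-cong k 𝟙-indep∨clique ⟩
    prodFin k (λ j → 𝟙 (partUniform π G j true) + 𝟙 (partUniform π G j false))
      ≡⟨ sym (sumVecs-prodFin k (λ j b → 𝟙 (partUniform π G j b))) ⟩
    sumVecs k (λ σ → prodFin k (λ j → 𝟙 (partUniform π G j (lookup σ j))))
      ≡⟨ sumVecs-cong k (λ σ → sym (𝟙-A-flip σ)) ⟩
    sumVecs k (λ σ → 𝟙 (A π (flipEdges (partMask (lookup σ)) G))) ∎
    where
    open ≡-Reasoning
    𝟙-indep∨clique : ∀ j → 𝟙 (partIndep π G j ∨ partClique π G j) ≡ 𝟙 (partClique π G j) + 𝟙 (partIndep π G j)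
    𝟙-indep∨clique j = trans (𝟙-∨ _ _ λ (indep , clique) → Uniform-unique π G (nontrivial j)
                                         (to (T-partUniform π G j false) indep) (to (T-partUniform π G j true) clique))
                             (+-comm (𝟙 (partIndep π G j)) _)
    𝟙-A-flip : ∀ σ → 𝟙 (A π (flipEdges (partMask (lookup σ)) G)) ≡ prodFin k (λ j → 𝟙 (partUniform π G j (lookup σ j)))
    𝟙-A-flip σ = trans (𝟙-all-allFin (partIndep π (flipEdges (partMask (lookup σ)) G)))
                       (prodFin-cong k (cong 𝟙 ∘ partIndep-flipEdges σ G))

  count-Aco : (∀ j → 2 ≤ size π j) → count (Aco π) ≡ 2 ^ k * count (A π)
  count-Aco nontrivial = begin
    count (Aco π)
      ≡⟨ count≡sumGraphs (Aco π) ⟩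
    sumGraphs (𝟙 ∘ Aco π)
      ≡⟨ sumVecs-cong (n * n) (𝟙-Aco nontrivial ∘ mkGraph) ⟩
    sumGraphs (λ G → sumVecs k (λ σ → 𝟙 (A π (flipEdges (partMask (lookup σ)) G))))
      ≡⟨ sumGraphs-average k (partMask ∘ lookup) (𝟙 ∘ A π) ⟩
    2 ^ k * sumGraphs (𝟙 ∘ A π)
      ≡⟨ cong (2 ^ k *_) (sym (count≡sumGraphs (A π))) ⟩
    2 ^ k * count (A π) ∎
    where open ≡-Reasoning

  partColour : Graph n → Fin k → Bool
  partColour G j = not (partIndep π G j)

  Uniform-partColour : ∀ G → T (Aco π G) → ∀ j → Uniform π G j (partColour G j)
  Uniform-partColour G aco j =
    to (T-partUniform π G j _) (indep∨clique (partIndep π G j) (to (T-all-allFin _) aco j))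
    where
    indep∨clique : ∀ i {c} → T (i ∨ c) → T (if not i then c else i)
    indep∨clique true  _ = _
    indep∨clique false c = c

  A-flipEdges : ∀ μ G (c : Fin k → Bool) → (∀ j u v → PairIn π j u v → μ u v ≡ c j) →
    (∀ j → Uniform π G j (c j)) → T (A π (flipEdges μ G))
  A-flipEdges μ G c μ≡c uniform = from (T-all-allFin _) λ j →
    from (T-partUniform π (flipEdges μ G) j false) (from (Uniform-flipEdges π μ G (μ≡c j)) (uniform j))

-- Two partitions

module _ {n k k′ : ℕ} (π : OrdPartition n k) (π′ : OrdPartition n k′) where

  doubleMask : (Fin k → Bool) → (Fin k′ → Bool) → Fin n → Fin n → Bool
  doubleMask c c′ u v = partMask π c u v ∨ partMask π′ c′ u v

  doubleMask-pairIn : ∀ G {c c′} → (∀ j → Uniform π G j (c j)) → (∀ j′ → Uniform π′ G j′ (c′ j′)) →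
    ∀ j u v → PairIn π j u v → doubleMask c c′ u v ≡ c j
  doubleMask-pairIn G {c} {c′} uniform uniform′ j u v uv∈j@(u<v , _) = begin
    partMask π c u v ∨ partMask π′ c′ u v  ≡⟨ cong (_∨ partMask π′ c′ u v) (partMask-pairIn π c j u v uv∈j) ⟩
    c j ∨ partMask π′ c′ u v              ≡⟨ ∨-∧-absorb (c j) _ _ same′⇒c′≡c ⟩
    c j                                   ∎
    where
    open ≡-Reasoning
    same′⇒c′≡c : T (part π′ u ==ᶠ part π′ v) → c′ (part π′ u) ≡ c j
    same′⇒c′≡c same′ = trans (sym (uniform′ _ u v (u<v , refl , sym (to T-==ᶠ same′)))) (uniform j u v uv∈j)

  partIndep-samePart : ∀ G j j′ → T (samePart π π′ j j′) → partIndep π G j ≡ partIndep π′ G j′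
  partIndep-samePart G j j′ same = all-cong (λ u → all-cong (λ v →
      cong₂ (λ a b → not ((toℕ u <ᵇ toℕ v) ∧ a ∧ b) ∨ not (adj G u v)) (inPart≡ u) (inPart≡ v))
    (allFin n)) (allFin n)
    where
    inPart≡ : ∀ v → (part π v ==ᶠ j) ≡ (part π′ v ==ᶠ j′)
    inPart≡ v = T-¬xor (to (T-all-allFin _) same v)

module _ {n k : ℕ} (π π′ : OrdPartition n k) where

  isCommon : Fin k → Bool
  isCommon j = any (samePart π π′ j) (allFin k)

  commonParts≡ : commonParts π π′ ≡ sumFin k (𝟙 ∘ isCommon)
  commonParts≡ = length-filter-T isCommon _ (allFin k)

  -- The π′-part containing a chosen vertex of V_j; when V_j is a common part, it is V_j itself.
  partner : Fin k → Fin k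
  partner j = part π′ (proj₁ (nonempty π j))

  partColour-common : ∀ G j → T (isCommon j) → partColour π G j ≡ partColour π′ G (partner j)
  partColour-common G j common with j′ , same ← T-any⇒∃ (samePart π π′ j) (allFin k) common =
    cong not (trans (partIndep-samePart π π′ G j j′ same) (cong (partIndep π′ G) (sym partner≡j′)))
    where
    v = proj₁ (nonempty π j)
    partner≡j′ : partner j ≡ j′
    partner≡j′ = to T-==ᶠ (subst T (T-¬xor (to (T-all-allFin _) same v)) (from T-==ᶠ (proj₂ (nonempty π j))))

  -- ρ is ignored on common parts, whose colour is read off σ′: this is where the factor 2^ℓ comes from.
  πColours : Vec Bool k → Vec Bool k → Fin k → Bool
  πColours σ′ ρ j = if isCommon j then lookup σ′ (partner j) else lookup ρ j

  flipBoth : Vec Bool k → Vec Bool k → Graph n → Graph n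
  flipBoth σ′ ρ = flipEdges (doubleMask π π′ (πColours σ′ ρ) (lookup σ′))

  A∧A′ : Graph n → Bool
  A∧A′ G = A π G ∧ A π′ G

  A∧A′-flipBoth : ∀ {G ρ} → T (Aco π G) → T (Aco π′ G) → T (agreesOff isCommon (partColour π G) ρ) →
    T (A∧A′ (flipBoth (Vec.tabulate (partColour π′ G)) ρ G))
  A∧A′-flipBoth {G} {ρ} aco aco′ agree = from T-∧
    ( A-flipEdges π μ G c (doubleMask-pairIn π π′ G uniform uniform′) uniform
    , A-flipEdges π′ μ G c′ (λ j′ u v uv∈j′ → trans (∨-comm (partMask π c u v) _)
                                                   (doubleMask-pairIn π′ π G uniform′ uniform j′ u v uv∈j′))
                  uniform′ )
    where
    c  = πColours (Vec.tabulate (partColour π′ G)) ρ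
    c′ = lookup (Vec.tabulate (partColour π′ G))
    μ  = doubleMask π π′ c c′
    c≡colour : ∀ j → c j ≡ partColour π G j
    c≡colour j with isCommon j in common
    ... | true  = trans (lookup∘tabulate (partColour π′ G) (partner j))
                        (sym (partColour-common G j (from T-≡ common)))
    ... | false = agreesOff⇒≡ {free = isCommon} {partColour π G} {ρ} agree j common
    uniform : ∀ j → Uniform π G j (c j)
    uniform j = subst (Uniform π G j) (sym (c≡colour j)) (Uniform-partColour π G aco j)
    uniform′ : ∀ j′ → Uniform π′ G j′ (c′ j′)
    uniform′ j′ = subst (Uniform π′ G j′) (sym (lookup∘tabulate (partColour π′ G) j′))
                        (Uniform-partColour π′ G aco′ j′)

  𝟙-Aco∧Aco′≤ : ∀ G → 2 ^ commonParts π π′ * 𝟙 (Aco π G ∧ Aco π′ G)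
                      ≤ sumVecs k (λ σ′ → sumVecs k (λ ρ → 𝟙 (A∧A′ (flipBoth σ′ ρ G))))
  𝟙-Aco∧Aco′≤ G = *-𝟙-≤ (Aco π G ∧ Aco π′ G) λ acos → let aco , aco′ = to T-∧ acos in begin
    2 ^ commonParts π π′
      ≡⟨ cong (2 ^_) commonParts≡ ⟩
    2 ^ sumFin k (𝟙 ∘ isCommon)
      ≡⟨ sym (sumVecs-agreesOff k isCommon (partColour π G)) ⟩
    sumVecs k (𝟙 ∘ agreesOff isCommon (partColour π G))
      ≤⟨ sumVecs-mono k (λ ρ → 𝟙-mono (A∧A′-flipBoth {G} {ρ} aco aco′)) ⟩
    sumVecs k (λ ρ → 𝟙 (A∧A′ (flipBoth σ′ᴳ ρ G)))
      ≤⟨ sumVecs-term k (λ σ′ → sumVecs k (λ ρ → 𝟙 (A∧A′ (flipBoth σ′ ρ G)))) σ′ᴳ ⟩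
    sumVecs k (λ σ′ → sumVecs k (λ ρ → 𝟙 (A∧A′ (flipBoth σ′ ρ G)))) ∎
    where
    open ≤-Reasoning
    σ′ᴳ = Vec.tabulate (partColour π′ G)

  count-Aco∧Aco′≤ : 2 ^ commonParts π π′ * count (λ G → Aco π G ∧ Aco π′ G) ≤ 2 ^ (2 * k) * count A∧A′
  count-Aco∧Aco′≤ = begin
    2 ^ ℓ * count (λ G → Aco π G ∧ Aco π′ G)
      ≡⟨ cong (2 ^ ℓ *_) (count≡sumGraphs (λ G → Aco π G ∧ Aco π′ G)) ⟩
    2 ^ ℓ * sumGraphs (λ G → 𝟙 (Aco π G ∧ Aco π′ G))
      ≡⟨ sym (sum-map-*ˡ (2 ^ ℓ) (λ b → 𝟙 (Aco π (mkGraph b) ∧ Aco π′ (mkGraph b))) (allVecs (n * n))) ⟩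
    sumGraphs (λ G → 2 ^ ℓ * 𝟙 (Aco π G ∧ Aco π′ G))
      ≤⟨ sumVecs-mono (n * n) (𝟙-Aco∧Aco′≤ ∘ mkGraph) ⟩
    sumGraphs (λ G → sumVecs k (λ σ′ → sumVecs k (λ ρ → 𝟙 (A∧A′ (flipBoth σ′ ρ G)))))
      ≡⟨ sum-map-swap (λ b σ′ → sumVecs k (λ ρ → 𝟙 (A∧A′ (flipBoth σ′ ρ (mkGraph b))))) (allVecs (n * n)) (allVecs k) ⟩
    sumVecs k (λ σ′ → sumGraphs (λ G → sumVecs k (λ ρ → 𝟙 (A∧A′ (flipBoth σ′ ρ G)))))
      ≡⟨ sumVecs-cong k (λ σ′ → sumGraphs-average k (λ ρ → doubleMask π π′ (πColours σ′ ρ) (lookup σ′)) (𝟙 ∘ A∧A′)) ⟩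
    sumVecs k (λ _ → 2 ^ k * sumGraphs (𝟙 ∘ A∧A′))
      ≡⟨ sumVecs-const k _ ⟩
    2 ^ k * (2 ^ k * sumGraphs (𝟙 ∘ A∧A′))
      ≡⟨ sym (*-assoc (2 ^ k) (2 ^ k) _) ⟩
    2 ^ k * 2 ^ k * sumGraphs (𝟙 ∘ A∧A′)
      ≡⟨ cong₂ _*_ (sym (^-distribˡ-+-* 2 k k)) (sym (count≡sumGraphs A∧A′)) ⟩
    2 ^ (k + k) * count A∧A′
      ≡⟨ cong (λ e → 2 ^ (k + e) * count A∧A′) (sym (+-identityʳ k)) ⟩
    2 ^ (2 * k) * count A∧A′ ∎
    where
    open ≤-Reasoning
    ℓ = commonParts π π′

2^-cancelˡ-≤ : ∀ {ℓ m x y} → ℓ ≤ m → 2 ^ ℓ * x ≤ 2 ^ m * y → x ≤ 2 ^ (m ∸ ℓ) * y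
2^-cancelˡ-≤ {ℓ} {m} {x} {y} ℓ≤m ≤y = *-cancelˡ-≤ (2 ^ ℓ) {{m^n≢0 2 ℓ}} (subst (2 ^ ℓ * x ≤_) split ≤y)
  where
  open ≡-Reasoning
  split : 2 ^ m * y ≡ 2 ^ ℓ * (2 ^ (m ∸ ℓ) * y)
  split = begin
    2 ^ m * y                  ≡⟨ cong (λ e → 2 ^ e * y) (sym (m+[n∸m]≡n ℓ≤m)) ⟩
    2 ^ (ℓ + (m ∸ ℓ)) * y      ≡⟨ cong (_* y) (^-distribˡ-+-* 2 ℓ (m ∸ ℓ)) ⟩
    2 ^ ℓ * 2 ^ (m ∸ ℓ) * y    ≡⟨ *-assoc (2 ^ ℓ) _ y ⟩
    2 ^ ℓ * (2 ^ (m ∸ ℓ) * y)  ∎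

proposition6 : (n k : ℕ) → 1 ≤ k → (kp : Fin n → ℕ) →
    isKProfile n k kp → isComplete n kp → k₁≡0 n kp →
    (π π' : OrdPartition n k) → HasProfile π kp → HasProfile π' kp →
    (count (Aco π) ≡ 2 ^ k * count (A π))
    × ((ℓ : ℕ) → ℓ ≤ k → commonParts π π' ≡ ℓ →
    count (λ G → Aco π G ∧ Aco π' G) ≤ 2 ^ (2 * k ∸ ℓ) * count (λ G → A π G ∧ A π' G))
proposition6 n k _ kp _ _ k₁≡0 π π′ profile _ =
  count-Aco π (k₁≡0⇒2≤size kp π k₁≡0 profile) ,
  λ ℓ ℓ≤k common≡ℓ → 2^-cancelˡ-≤ (≤-trans ℓ≤k (m≤m+n k (k + 0)))
    (subst (λ e → 2 ^ e * count (λ G → Aco π G ∧ Aco π′ G) ≤ _) common≡ℓ (count-Aco∧Aco′≤ π π′))
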